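{- For every integer $b\ge1$, a $\mathrm{LC}((2b)^2b^1)$, a $\mathrm{LC}((3b)^2(2b)^1)$ and a $\mathrm{LC}((4b)^2(3b)^1)$ exist.
   Context: A latin cube of order $N$ is an $N\times N\times N$ array on $N$ symbols such that any two cells whose coordinates differ in exactly one position contain different symbols; a subcube is an $m\times m\times m$ subarray (indices in each coordinate from chosen $m$-sets) that is itself a latin cube of order $m$; subcubes are disjoint if they share no index in any coordinate and no symbol. $\mathrm{LC}(x^2y^1)$ denotes a latin cube of order $2x+y$ with pairwise disjoint subcubes of orders $x$, $x$, $y$. -}

module Defs where

open import Data.Nat using (ℕ; _+_; _*_)
open import Data.Fin using (Fin)
open import Data.Fin.Subset using (Subset; _∈_; ∣_∣; _∩_; Empty)
open import Data.Product using (Σ; _×_; _,_)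
open import Relation.Binary.PropositionalEquality using (_≡_; _≢_)

Cube : ℕ → Set
Cube N = Fin N → Fin N → Fin N → Fin N

IsLatinCube : (N : ℕ) → Cube N → Set
IsLatinCube N L =
  (∀ i i′ j k → i ≢ i′ → L i j k ≢ L i′ j k) ×
  (∀ i j j′ k → j ≢ j′ → L i j k ≢ L i j′ k) ×
  (∀ i j k k′ → k ≢ k′ → L i j k ≢ L i j k′)

-- A subcube of order m: index sets R, C, F (one per coordinate) each of size m,
-- and a symbol set S of size m, such that the m×m×m subarray R×C×F uses only
-- symbols from S, i.e. the subarray is itself a latin cube of order m on S
-- (the latin condition along lines is inherited from L).
record Subcube (N : ℕ) (L : Cube N) (m : ℕ) : Set where
  field
    rows  : Subset N
    cols  : Subset N
    files : Subset N
    syms  : Subset N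
    rows-size  : ∣ rows ∣ ≡ m
    cols-size  : ∣ cols ∣ ≡ m
    files-size : ∣ files ∣ ≡ m
    syms-size  : ∣ syms ∣ ≡ m
    closed : ∀ i j k → i ∈ rows → j ∈ cols → k ∈ files → L i j k ∈ syms

open Subcube public

Disjoint : ∀ {N L m m′} → Subcube N L m → Subcube N L m′ → Set
Disjoint P Q =
  Empty (rows P ∩ rows Q) × Empty (cols P ∩ cols Q) ×
  Empty (files P ∩ files Q) × Empty (syms P ∩ syms Q)

LC-x²y¹ : ℕ → ℕ → Set
LC-x²y¹ x y =
  Σ (Cube (x + x + y)) λ L → IsLatinCube (x + x + y) L ×
  Σ (Subcube (x + x + y) L x) λ P →
  Σ (Subcube (x + x + y) L x) λ Q →
  Σ (Subcube (x + x + y) L y) λ R →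
  Disjoint P Q × Disjoint P R × Disjoint Q R

-- If L is a latin cube of order n and T one of order b, then on Fin (n * b) ≅ Fin n × Fin b
-- the direct product (L ⊗ T) (i₁,i₂) (j₁,j₂) (k₁,k₂) = (L i₁ j₁ k₁ , T i₂ j₂ k₂) is latin, and
-- each subcube S of L of order m inflates to the subcube S × Fin b of order m * b, disjoint
-- subcubes staying disjoint.  Taking for T the cyclic cube x + y + z (mod b), every LC(x²y¹)
-- yields an LC((xb)²(yb)¹).  It remains to exhibit an LC(2²1¹), an LC(3²2¹) and an LC(4²3¹),
-- of orders 5, 8 and 11: explicit cubes whose subcubes occupy three consecutive diagonal
-- blocks, with all required properties checked by evaluation.
module Submission where

open import Defs
open import Data.Bool using (Bool; true; false; _∧_)
open import Data.Fin using (Fin; #_; toℕ; combine; quotient; remainder; _≟_)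
open import Data.Fin.Properties using (all?; toℕ-injective; toℕ-fromℕ<; toℕ<n; combine-remQuot; remQuot-combine; combine-injective)
open import Data.Fin.Subset using (Subset; _∈_; ∣_∣; _∩_; Empty; ⊤; ⊥; inside; outside)
open import Data.Fin.Subset.Properties using (_∈?_; ∉⊥; ∣⊤∣≡n; ∣⊥∣≡0; x∈p∩q⁺; x∈p∩q⁻)
open import Data.Nat using (ℕ; zero; suc; _+_; _*_; _∸_; _≥_; NonZero; >-nonZero)
open import Data.Nat.DivMod using (_%_; _mod_; %-distribˡ-+; m%n%n≡m%n; [m+n]%n≡m%n; m<n⇒m%n≡m; m%n<n)
open import Data.Nat.Properties using (+-comm; +-assoc; +-identityʳ; *-distribʳ-+; *-identityˡ; m+[n∸m]≡n; <⇒≤)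
open import Data.Product using (Σ; _×_; _,_; proj₁; proj₂)
open import Data.Vec using (Vec; []; _∷_; lookup; replicate; concat; map; _++_)
open import Data.Vec.Properties using (lookup-concat; lookup-map; lookup-replicate; []=⇒lookup; lookup⇒[]=; zipWith-++; zipWith-replicate)
open import Relation.Binary.PropositionalEquality using (_≡_; _≢_; refl; sym; trans; cong; cong₂; subst; module ≡-Reasoning)
open import Relation.Nullary using (Dec; ¬?)
open import Relation.Nullary.Decidable using (from-yes; decidable-stable; _×-dec_; _→-dec_)

[m%n+o]%n≡[m+o]%n : ∀ m o n .{{_ : NonZero n}} → (m % n + o) % n ≡ (m + o) % n
[m%n+o]%n≡[m+o]%n m o n = begin
  (m % n + o) % n         ≡⟨ %-distribˡ-+ (m % n) o n ⟩
  (m % n % n + o % n) % n ≡⟨ cong (λ v → (v + o % n) % n) (m%n%n≡m%n m n) ⟩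
  (m % n + o % n) % n     ≡⟨ %-distribˡ-+ m o n ⟨
  (m + o) % n             ∎
  where open ≡-Reasoning

∣p++q∣≡∣p∣+∣q∣ : ∀ {m n} (p : Subset m) (q : Subset n) → ∣ p ++ q ∣ ≡ ∣ p ∣ + ∣ q ∣
∣p++q∣≡∣p∣+∣q∣ []            q = refl
∣p++q∣≡∣p∣+∣q∣ (inside  ∷ p) q = cong suc (∣p++q∣≡∣p∣+∣q∣ p q)
∣p++q∣≡∣p∣+∣q∣ (outside ∷ p) q = ∣p++q∣≡∣p∣+∣q∣ p q

⊥++⊥ : ∀ {m n} → ⊥ {m} ++ ⊥ {n} ≡ ⊥
⊥++⊥ {zero}  = refl
⊥++⊥ {suc m} = cong (outside ∷_) (⊥++⊥ {m})

module Cyclic (b : ℕ) .{{_ : NonZero b}} where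

  infixl 6 _⊕_

  _⊕_ : Fin b → Fin b → Fin b
  x ⊕ y = (toℕ x + toℕ y) mod b

  ⊕-comm : ∀ x y → x ⊕ y ≡ y ⊕ x
  ⊕-comm x y = cong (_mod b) (+-comm (toℕ x) (toℕ y))

  ⊕-cancelʳ : ∀ e {x y} → x ⊕ e ≡ y ⊕ e → x ≡ y
  ⊕-cancelʳ e {x} {y} eq = toℕ-injective (begin
    toℕ x                       ≡⟨ untranslate x ⟨
    (toℕ (x ⊕ e) + (b ∸ ê)) % b ≡⟨ cong (λ z → (toℕ z + (b ∸ ê)) % b) eq ⟩
    (toℕ (y ⊕ e) + (b ∸ ê)) % b ≡⟨ untranslate y ⟩
    toℕ y                       ∎)
    where
    open ≡-Reasoning

    ê : ℕ
    ê = toℕ e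

    untranslate : ∀ a → (toℕ (a ⊕ e) + (b ∸ ê)) % b ≡ toℕ a
    untranslate a = begin
      (toℕ (a ⊕ e) + (b ∸ ê)) % b     ≡⟨ cong (λ v → (v + (b ∸ ê)) % b) (toℕ-fromℕ< (m%n<n (toℕ a + ê) b)) ⟩
      ((toℕ a + ê) % b + (b ∸ ê)) % b ≡⟨ [m%n+o]%n≡[m+o]%n (toℕ a + ê) (b ∸ ê) b ⟩
      (toℕ a + ê + (b ∸ ê)) % b       ≡⟨ cong (_% b) (+-assoc (toℕ a) ê (b ∸ ê)) ⟩
      (toℕ a + (ê + (b ∸ ê))) % b     ≡⟨ cong (λ v → (toℕ a + v) % b) (m+[n∸m]≡n (<⇒≤ (toℕ<n e))) ⟩
      (toℕ a + b) % b                 ≡⟨ [m+n]%n≡m%n (toℕ a) b ⟩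
      toℕ a % b                       ≡⟨ m<n⇒m%n≡m (toℕ<n a) ⟩
      toℕ a                           ∎

  ⊕-cancelˡ : ∀ e {x y} → e ⊕ x ≡ e ⊕ y → x ≡ y
  ⊕-cancelˡ e {x} {y} eq = ⊕-cancelʳ e (trans (⊕-comm x e) (trans eq (⊕-comm e y)))

  cyclic : Cube b
  cyclic x y z = x ⊕ y ⊕ z

  cyclic-isLatinCube : IsLatinCube b cyclic
  cyclic-isLatinCube =
      (λ x x′ y z x≢x′ eq → x≢x′ (⊕-cancelʳ y (⊕-cancelʳ z eq)))
    , (λ x y y′ z y≢y′ eq → y≢y′ (⊕-cancelˡ x (⊕-cancelʳ z eq)))
    , (λ x y z z′ z≢z′ eq → z≢z′ (⊕-cancelˡ (x ⊕ y) eq))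

open Cyclic using (cyclic-isLatinCube)

-- LC-x²y¹ with the order N not required to be literally x + x + y.
LC-x²y¹-of-order : ℕ → ℕ → ℕ → Set
LC-x²y¹-of-order N x y =
  Σ (Cube N) λ L → IsLatinCube N L ×
  Σ (Subcube N L x) λ P →
  Σ (Subcube N L x) λ Q →
  Σ (Subcube N L y) λ R →
  Disjoint P Q × Disjoint P R × Disjoint Q R

inflate : ∀ {n} b → Subset n → Subset (n * b)
inflate b s = concat (map (replicate b) s)

∣inflate∣ : ∀ {n} b (s : Subset n) → ∣ inflate b s ∣ ≡ ∣ s ∣ * b
∣inflate∣ b []            = refl
∣inflate∣ b (inside  ∷ s) = trans (∣p++q∣≡∣p∣+∣q∣ (⊤ {b}) (inflate b s)) (cong₂ _+_ (∣⊤∣≡n b) (∣inflate∣ b s))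
∣inflate∣ b (outside ∷ s) = trans (∣p++q∣≡∣p∣+∣q∣ (⊥ {b}) (inflate b s)) (cong₂ _+_ (∣⊥∣≡0 b) (∣inflate∣ b s))

module Product {n b : ℕ} where

  q : Fin (n * b) → Fin n
  q = quotient b

  r : Fin (n * b) → Fin b
  r = remainder {n} b

  q-combine : ∀ a t → q (combine a t) ≡ a
  q-combine a t = cong proj₁ (remQuot-combine a t)

  q,r-injective : ∀ {i i′} → q i ≡ q i′ → r i ≡ r i′ → i ≡ i′
  q,r-injective {i} {i′} q≡ r≡ =
    trans (sym (combine-remQuot {n} b i)) (trans (cong₂ combine q≡ r≡) (combine-remQuot {n} b i′))

  _⊗_ : Cube n → Cube b → Cube (n * b)
  (L ⊗ T) i j k = combine (L (q i) (q j) (q k)) (T (r i) (r j) (r k))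

  ⊗-separates : ∀ {f : Fin n → Fin n} {g : Fin b → Fin b} →
    (∀ a a′ → a ≢ a′ → f a ≢ f a′) → (∀ t t′ → t ≢ t′ → g t ≢ g t′) →
    ∀ i i′ → i ≢ i′ → combine (f (q i)) (g (r i)) ≢ combine (f (q i′)) (g (r i′))
  ⊗-separates {f} {g} f-sep g-sep i i′ i≢i′ eq = i≢i′ (q,r-injective q≡ r≡)
    where
    f≡ : f (q i) ≡ f (q i′)
    f≡ = proj₁ (combine-injective (f (q i)) (g (r i)) (f (q i′)) (g (r i′)) eq)

    g≡ : g (r i) ≡ g (r i′)
    g≡ = proj₂ (combine-injective (f (q i)) (g (r i)) (f (q i′)) (g (r i′)) eq)

    q≡ : q i ≡ q i′
    q≡ = decidable-stable (q i ≟ q i′) λ ne → f-sep _ _ ne f≡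

    r≡ : r i ≡ r i′
    r≡ = decidable-stable (r i ≟ r i′) λ ne → g-sep _ _ ne g≡

  ⊗-isLatinCube : ∀ {L T} → IsLatinCube n L → IsLatinCube b T → IsLatinCube (n * b) (L ⊗ T)
  ⊗-isLatinCube (L₁ , L₂ , L₃) (T₁ , T₂ , T₃) =
      (λ i i′ j k → ⊗-separates (λ a a′ → L₁ a a′ (q j) (q k)) (λ t t′ → T₁ t t′ (r j) (r k)) i i′)
    , (λ i j j′ k → ⊗-separates (λ a a′ → L₂ (q i) a a′ (q k)) (λ t t′ → T₂ (r i) t t′ (r k)) j j′)
    , (λ i j k k′ → ⊗-separates (λ a a′ → L₃ (q i) (q j) a a′) (λ t t′ → T₃ (r i) (r j) t t′) k k′)

  lookup-inflate : ∀ s i → lookup (inflate b s) i ≡ lookup s (q i)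
  lookup-inflate s i = begin
    lookup (inflate b s) i                             ≡⟨ cong (lookup (inflate b s)) (combine-remQuot {n} b i) ⟨
    lookup (inflate b s) (combine (q i) (r i))         ≡⟨ lookup-concat (map (replicate b) s) (q i) (r i) ⟩
    lookup (lookup (map (replicate b) s) (q i)) (r i)  ≡⟨ cong (λ v → lookup v (r i)) (lookup-map (q i) (replicate b) s) ⟩
    lookup (replicate b (lookup s (q i))) (r i)        ≡⟨ lookup-replicate (r i) (lookup s (q i)) ⟩
    lookup s (q i)                                     ∎
    where open ≡-Reasoning

  ∈-inflate⁻ : ∀ {s i} → i ∈ inflate b s → q i ∈ s
  ∈-inflate⁻ {s} {i} i∈ = lookup⇒[]= (q i) s (trans (sym (lookup-inflate s i)) ([]=⇒lookup i∈))

  ∈-inflate⁺ : ∀ {s i} → q i ∈ s → i ∈ inflate b s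
  ∈-inflate⁺ {s} {i} qi∈ = lookup⇒[]= i (inflate b s) (trans (lookup-inflate s i) ([]=⇒lookup qi∈))

  inflate-∩-empty : ∀ {s t} → Empty (s ∩ t) → Empty (inflate b s ∩ inflate b t)
  inflate-∩-empty s∩t-empty (i , i∈) with x∈p∩q⁻ _ _ i∈
  ... | i∈s , i∈t = s∩t-empty (q i , x∈p∩q⁺ (∈-inflate⁻ i∈s , ∈-inflate⁻ i∈t))

  inflateSubcube : ∀ {L m} (T : Cube b) → Subcube n L m → Subcube (n * b) (L ⊗ T) (m * b)
  inflateSubcube {m = m} T P = record
    { rows = inflate b (rows P) ; cols = inflate b (cols P) ; files = inflate b (files P) ; syms = inflate b (syms P)
    ; rows-size  = inflated-size (rows P) (rows-size P)
    ; cols-size  = inflated-size (cols P) (cols-size P)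
    ; files-size = inflated-size (files P) (files-size P)
    ; syms-size  = inflated-size (syms P) (syms-size P)
    ; closed = λ i j k i∈ j∈ k∈ → ∈-inflate⁺ (subst (_∈ syms P) (sym (q-combine _ _))
        (closed P (q i) (q j) (q k) (∈-inflate⁻ i∈) (∈-inflate⁻ j∈) (∈-inflate⁻ k∈)))
    }
    where
    inflated-size : ∀ s → ∣ s ∣ ≡ m → ∣ inflate b s ∣ ≡ m * b
    inflated-size s ∣s∣≡m = trans (∣inflate∣ b s) (cong (_* b) ∣s∣≡m)

  inflate-disjoint : ∀ {L m m′} (T : Cube b) (P : Subcube n L m) (Q : Subcube n L m′) →
    Disjoint P Q → Disjoint (inflateSubcube T P) (inflateSubcube T Q)
  inflate-disjoint T P Q (rows∅ , cols∅ , files∅ , syms∅) =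
    inflate-∩-empty rows∅ , inflate-∩-empty cols∅ , inflate-∩-empty files∅ , inflate-∩-empty syms∅

  ⊗-LC : ∀ {x y} {T : Cube b} → IsLatinCube b T →
    LC-x²y¹-of-order n x y → LC-x²y¹-of-order (n * b) (x * b) (y * b)
  ⊗-LC {T = T} T-latin (L , L-latin , P , Q , R , P∥Q , P∥R , Q∥R) =
      L ⊗ T , ⊗-isLatinCube {L} {T} L-latin T-latin
    , inflateSubcube T P , inflateSubcube T Q , inflateSubcube T R
    , inflate-disjoint T P Q P∥Q , inflate-disjoint T P R P∥R , inflate-disjoint T Q R Q∥R

open Product using (⊗-LC)

LC-x²y¹-scale : ∀ {x y} b .{{_ : NonZero b}} → LC-x²y¹ x y → LC-x²y¹ (x * b) (y * b)
LC-x²y¹-scale {x} {y} b lc =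
  subst (λ N → LC-x²y¹-of-order N (x * b) (y * b)) order-distrib (⊗-LC (cyclic-isLatinCube b) lc)
  where
  order-distrib : (x + x + y) * b ≡ x * b + x * b + y * b
  order-distrib = trans (*-distribʳ-+ b (x + x) y) (cong (_+ y * b) (*-distribʳ-+ b x x))

Closed : ∀ {n} → Cube n → Subset n → Set
Closed L s = ∀ i j k → i ∈ s → j ∈ s → k ∈ s → L i j k ∈ s

diagonalSubcube : ∀ {n m} {L : Cube n} (s : Subset n) → ∣ s ∣ ≡ m → Closed L s → Subcube n L m
diagonalSubcube s ∣s∣≡m closed-s = record
  { rows = s ; cols = s ; files = s ; syms = s
  ; rows-size = ∣s∣≡m ; cols-size = ∣s∣≡m ; files-size = ∣s∣≡m ; syms-size = ∣s∣≡m
  ; closed = closed-s }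

block : ∀ x y → Bool → Bool → Bool → Subset (x + x + y)
block x y u v w = (replicate x u ++ replicate x v) ++ replicate y w

block-∩ : ∀ x y u v w u′ v′ w′ → block x y u v w ∩ block x y u′ v′ w′ ≡ block x y (u ∧ u′) (v ∧ v′) (w ∧ w′)
block-∩ x y u v w u′ v′ w′ =
  trans (zipWith-++ _∧_ (replicate x u ++ replicate x v) (replicate y w) (replicate x u′ ++ replicate x v′) (replicate y w′))
        (cong₂ _++_
          (trans (zipWith-++ _∧_ (replicate x u) (replicate x v) (replicate x u′) (replicate x v′))
                 (cong₂ _++_ (zipWith-replicate {n = x} _∧_ u u′) (zipWith-replicate {n = x} _∧_ v v′)))
          (zipWith-replicate _∧_ w w′))

block-empty : ∀ x y → Empty (block x y false false false)
block-empty x y (i , i∈) = ∉⊥ (subst (i ∈_) (trans (cong (_++ ⊥) (⊥++⊥ {x})) (⊥++⊥ {x + x})) i∈)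

∣block∣ : ∀ x y u v w → ∣ block x y u v w ∣ ≡ ∣ replicate x u ∣ + ∣ replicate x v ∣ + ∣ replicate y w ∣
∣block∣ x y u v w =
  trans (∣p++q∣≡∣p∣+∣q∣ (replicate x u ++ replicate x v) (replicate y w))
        (cong (_+ ∣ replicate y w ∣) (∣p++q∣≡∣p∣+∣q∣ (replicate x u) (replicate x v)))

IsDiagonalLC : ∀ x y → Cube (x + x + y) → Set
IsDiagonalLC x y L =
  IsLatinCube _ L ×
  Closed L (block x y true false false) × Closed L (block x y false true false) × Closed L (block x y false false true)

diagonalLC : ∀ x y (L : Cube (x + x + y)) → IsDiagonalLC x y L → LC-x²y¹ x y
diagonalLC x y L (L-latin , P-closed , Q-closed , R-closed) =
    L , L-latin
  , diagonalSubcube _ ∣P∣ P-closed , diagonalSubcube _ ∣Q∣ Q-closed , diagonalSubcube _ ∣R∣ R-closed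
  , disjoint (block-∩ x y true false false false true false)
  , disjoint (block-∩ x y true false false false false true)
  , disjoint (block-∩ x y false true false false false true)
  where
  open ≡-Reasoning

  ∣P∣ : ∣ block x y true false false ∣ ≡ x
  ∣P∣ = begin
    ∣ block x y true false false ∣    ≡⟨ ∣block∣ x y true false false ⟩
    ∣ ⊤ {x} ∣ + ∣ ⊥ {x} ∣ + ∣ ⊥ {y} ∣ ≡⟨ cong₂ _+_ (cong₂ _+_ (∣⊤∣≡n x) (∣⊥∣≡0 x)) (∣⊥∣≡0 y) ⟩
    x + 0 + 0                         ≡⟨ trans (+-identityʳ (x + 0)) (+-identityʳ x) ⟩
    x                                 ∎

  ∣Q∣ : ∣ block x y false true false ∣ ≡ x
  ∣Q∣ = begin
    ∣ block x y false true false ∣    ≡⟨ ∣block∣ x y false true false ⟩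
    ∣ ⊥ {x} ∣ + ∣ ⊤ {x} ∣ + ∣ ⊥ {y} ∣ ≡⟨ cong₂ _+_ (cong₂ _+_ (∣⊥∣≡0 x) (∣⊤∣≡n x)) (∣⊥∣≡0 y) ⟩
    x + 0                             ≡⟨ +-identityʳ x ⟩
    x                                 ∎

  ∣R∣ : ∣ block x y false false true ∣ ≡ y
  ∣R∣ = begin
    ∣ block x y false false true ∣    ≡⟨ ∣block∣ x y false false true ⟩
    ∣ ⊥ {x} ∣ + ∣ ⊥ {x} ∣ + ∣ ⊤ {y} ∣ ≡⟨ cong₂ _+_ (cong₂ _+_ (∣⊥∣≡0 x) (∣⊥∣≡0 x)) (∣⊤∣≡n y) ⟩
    y                                 ∎

  disjoint : ∀ {s t} → s ∩ t ≡ block x y false false false →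
    Empty (s ∩ t) × Empty (s ∩ t) × Empty (s ∩ t) × Empty (s ∩ t)
  disjoint {s} {t} s∩t≡∅ = ∅ , ∅ , ∅ , ∅
    where
    ∅ : Empty (s ∩ t)
    ∅ = subst Empty (sym s∩t≡∅) (block-empty x y)

isLatinCube? : ∀ {n} (L : Cube n) → Dec (IsLatinCube n L)
isLatinCube? L =
        (all? λ i → all? λ i′ → all? λ j → all? λ k → ¬? (i ≟ i′) →-dec ¬? (L i j k ≟ L i′ j k))
  ×-dec (all? λ i → all? λ j → all? λ j′ → all? λ k → ¬? (j ≟ j′) →-dec ¬? (L i j k ≟ L i j′ k))
  ×-dec (all? λ i → all? λ j → all? λ k → all? λ k′ → ¬? (k ≟ k′) →-dec ¬? (L i j k ≟ L i j k′))

closed? : ∀ {n} (L : Cube n) (s : Subset n) → Dec (Closed L s)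
closed? L s = all? λ i → all? λ j → all? λ k → i ∈? s →-dec j ∈? s →-dec k ∈? s →-dec L i j k ∈? s

isDiagonalLC? : ∀ x y (L : Cube (x + x + y)) → Dec (IsDiagonalLC x y L)
isDiagonalLC? x y L =
        isLatinCube? L
  ×-dec closed? L (block x y true false false)
  ×-dec closed? L (block x y false true false)
  ×-dec closed? L (block x y false false true)

Table : ℕ → Set
Table n = Vec (Vec (Vec (Fin n) n) n) n

fromTable : ∀ {n} → Table n → Cube n
fromTable V i j k = lookup (lookup (lookup V i) j) k

table₅ : Table 5
table₅ =
  ( (# 0 ∷ # 1 ∷ # 2 ∷ # 3 ∷ # 4 ∷ []) ∷
    (# 1 ∷ # 0 ∷ # 4 ∷ # 2 ∷ # 3 ∷ []) ∷
    (# 3 ∷ # 2 ∷ # 1 ∷ # 4 ∷ # 0 ∷ []) ∷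
    (# 4 ∷ # 3 ∷ # 0 ∷ # 1 ∷ # 2 ∷ []) ∷
    (# 2 ∷ # 4 ∷ # 3 ∷ # 0 ∷ # 1 ∷ []) ∷ []) ∷
  ( (# 1 ∷ # 0 ∷ # 3 ∷ # 4 ∷ # 2 ∷ []) ∷
    (# 0 ∷ # 1 ∷ # 2 ∷ # 3 ∷ # 4 ∷ []) ∷
    (# 2 ∷ # 4 ∷ # 0 ∷ # 1 ∷ # 3 ∷ []) ∷
    (# 3 ∷ # 2 ∷ # 4 ∷ # 0 ∷ # 1 ∷ []) ∷
    (# 4 ∷ # 3 ∷ # 1 ∷ # 2 ∷ # 0 ∷ []) ∷ []) ∷
  ( (# 4 ∷ # 2 ∷ # 1 ∷ # 0 ∷ # 3 ∷ []) ∷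
    (# 2 ∷ # 3 ∷ # 0 ∷ # 4 ∷ # 1 ∷ []) ∷
    (# 0 ∷ # 1 ∷ # 3 ∷ # 2 ∷ # 4 ∷ []) ∷
    (# 1 ∷ # 4 ∷ # 2 ∷ # 3 ∷ # 0 ∷ []) ∷
    (# 3 ∷ # 0 ∷ # 4 ∷ # 1 ∷ # 2 ∷ []) ∷ []) ∷
  ( (# 2 ∷ # 3 ∷ # 4 ∷ # 1 ∷ # 0 ∷ []) ∷
    (# 3 ∷ # 4 ∷ # 1 ∷ # 0 ∷ # 2 ∷ []) ∷
    (# 4 ∷ # 0 ∷ # 2 ∷ # 3 ∷ # 1 ∷ []) ∷
    (# 0 ∷ # 1 ∷ # 3 ∷ # 2 ∷ # 4 ∷ []) ∷
    (# 1 ∷ # 2 ∷ # 0 ∷ # 4 ∷ # 3 ∷ []) ∷ []) ∷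
  ( (# 3 ∷ # 4 ∷ # 0 ∷ # 2 ∷ # 1 ∷ []) ∷
    (# 4 ∷ # 2 ∷ # 3 ∷ # 1 ∷ # 0 ∷ []) ∷
    (# 1 ∷ # 3 ∷ # 4 ∷ # 0 ∷ # 2 ∷ []) ∷
    (# 2 ∷ # 0 ∷ # 1 ∷ # 4 ∷ # 3 ∷ []) ∷
    (# 0 ∷ # 1 ∷ # 2 ∷ # 3 ∷ # 4 ∷ []) ∷ []) ∷
  []

table₈ : Table 8
table₈ =
  ( (# 1 ∷ # 0 ∷ # 2 ∷ # 3 ∷ # 7 ∷ # 5 ∷ # 6 ∷ # 4 ∷ []) ∷
    (# 2 ∷ # 1 ∷ # 0 ∷ # 7 ∷ # 6 ∷ # 4 ∷ # 5 ∷ # 3 ∷ []) ∷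
    (# 0 ∷ # 2 ∷ # 1 ∷ # 6 ∷ # 5 ∷ # 3 ∷ # 4 ∷ # 7 ∷ []) ∷
    (# 6 ∷ # 4 ∷ # 3 ∷ # 0 ∷ # 2 ∷ # 7 ∷ # 1 ∷ # 5 ∷ []) ∷
    (# 7 ∷ # 5 ∷ # 4 ∷ # 1 ∷ # 0 ∷ # 6 ∷ # 3 ∷ # 2 ∷ []) ∷
    (# 4 ∷ # 3 ∷ # 5 ∷ # 2 ∷ # 1 ∷ # 0 ∷ # 7 ∷ # 6 ∷ []) ∷
    (# 3 ∷ # 7 ∷ # 6 ∷ # 5 ∷ # 4 ∷ # 1 ∷ # 2 ∷ # 0 ∷ []) ∷
    (# 5 ∷ # 6 ∷ # 7 ∷ # 4 ∷ # 3 ∷ # 2 ∷ # 0 ∷ # 1 ∷ []) ∷ []) ∷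
  ( (# 2 ∷ # 1 ∷ # 0 ∷ # 4 ∷ # 6 ∷ # 3 ∷ # 5 ∷ # 7 ∷ []) ∷
    (# 0 ∷ # 2 ∷ # 1 ∷ # 3 ∷ # 4 ∷ # 7 ∷ # 6 ∷ # 5 ∷ []) ∷
    (# 1 ∷ # 0 ∷ # 2 ∷ # 5 ∷ # 7 ∷ # 6 ∷ # 3 ∷ # 4 ∷ []) ∷
    (# 3 ∷ # 5 ∷ # 4 ∷ # 1 ∷ # 0 ∷ # 2 ∷ # 7 ∷ # 6 ∷ []) ∷
    (# 4 ∷ # 6 ∷ # 5 ∷ # 7 ∷ # 1 ∷ # 0 ∷ # 2 ∷ # 3 ∷ []) ∷
    (# 5 ∷ # 7 ∷ # 3 ∷ # 6 ∷ # 2 ∷ # 1 ∷ # 4 ∷ # 0 ∷ []) ∷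
    (# 6 ∷ # 4 ∷ # 7 ∷ # 2 ∷ # 3 ∷ # 5 ∷ # 0 ∷ # 1 ∷ []) ∷
    (# 7 ∷ # 3 ∷ # 6 ∷ # 0 ∷ # 5 ∷ # 4 ∷ # 1 ∷ # 2 ∷ []) ∷ []) ∷
  ( (# 0 ∷ # 2 ∷ # 1 ∷ # 6 ∷ # 3 ∷ # 7 ∷ # 4 ∷ # 5 ∷ []) ∷
    (# 1 ∷ # 0 ∷ # 2 ∷ # 4 ∷ # 5 ∷ # 6 ∷ # 3 ∷ # 7 ∷ []) ∷
    (# 2 ∷ # 1 ∷ # 0 ∷ # 7 ∷ # 4 ∷ # 5 ∷ # 6 ∷ # 3 ∷ []) ∷
    (# 4 ∷ # 3 ∷ # 7 ∷ # 2 ∷ # 6 ∷ # 0 ∷ # 5 ∷ # 1 ∷ []) ∷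
    (# 5 ∷ # 4 ∷ # 3 ∷ # 0 ∷ # 2 ∷ # 1 ∷ # 7 ∷ # 6 ∷ []) ∷
    (# 3 ∷ # 5 ∷ # 6 ∷ # 1 ∷ # 7 ∷ # 2 ∷ # 0 ∷ # 4 ∷ []) ∷
    (# 7 ∷ # 6 ∷ # 5 ∷ # 3 ∷ # 0 ∷ # 4 ∷ # 1 ∷ # 2 ∷ []) ∷
    (# 6 ∷ # 7 ∷ # 4 ∷ # 5 ∷ # 1 ∷ # 3 ∷ # 2 ∷ # 0 ∷ []) ∷ []) ∷
  ( (# 7 ∷ # 4 ∷ # 5 ∷ # 1 ∷ # 0 ∷ # 6 ∷ # 3 ∷ # 2 ∷ []) ∷
    (# 4 ∷ # 5 ∷ # 3 ∷ # 2 ∷ # 1 ∷ # 0 ∷ # 7 ∷ # 6 ∷ []) ∷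
    (# 6 ∷ # 3 ∷ # 4 ∷ # 0 ∷ # 2 ∷ # 7 ∷ # 1 ∷ # 5 ∷ []) ∷
    (# 2 ∷ # 7 ∷ # 1 ∷ # 5 ∷ # 4 ∷ # 3 ∷ # 6 ∷ # 0 ∷ []) ∷
    (# 1 ∷ # 2 ∷ # 6 ∷ # 3 ∷ # 5 ∷ # 4 ∷ # 0 ∷ # 7 ∷ []) ∷
    (# 0 ∷ # 6 ∷ # 7 ∷ # 4 ∷ # 3 ∷ # 5 ∷ # 2 ∷ # 1 ∷ []) ∷
    (# 5 ∷ # 1 ∷ # 0 ∷ # 7 ∷ # 6 ∷ # 2 ∷ # 4 ∷ # 3 ∷ []) ∷
    (# 3 ∷ # 0 ∷ # 2 ∷ # 6 ∷ # 7 ∷ # 1 ∷ # 5 ∷ # 4 ∷ []) ∷ []) ∷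
  ( (# 5 ∷ # 6 ∷ # 4 ∷ # 7 ∷ # 1 ∷ # 0 ∷ # 2 ∷ # 3 ∷ []) ∷
    (# 3 ∷ # 7 ∷ # 5 ∷ # 6 ∷ # 2 ∷ # 1 ∷ # 4 ∷ # 0 ∷ []) ∷
    (# 4 ∷ # 5 ∷ # 3 ∷ # 1 ∷ # 0 ∷ # 2 ∷ # 7 ∷ # 6 ∷ []) ∷
    (# 7 ∷ # 1 ∷ # 6 ∷ # 3 ∷ # 5 ∷ # 4 ∷ # 0 ∷ # 2 ∷ []) ∷
    (# 2 ∷ # 0 ∷ # 7 ∷ # 4 ∷ # 3 ∷ # 5 ∷ # 6 ∷ # 1 ∷ []) ∷
    (# 6 ∷ # 2 ∷ # 0 ∷ # 5 ∷ # 4 ∷ # 3 ∷ # 1 ∷ # 7 ∷ []) ∷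
    (# 1 ∷ # 3 ∷ # 2 ∷ # 0 ∷ # 7 ∷ # 6 ∷ # 5 ∷ # 4 ∷ []) ∷
    (# 0 ∷ # 4 ∷ # 1 ∷ # 2 ∷ # 6 ∷ # 7 ∷ # 3 ∷ # 5 ∷ []) ∷ []) ∷
  ( (# 4 ∷ # 5 ∷ # 3 ∷ # 0 ∷ # 2 ∷ # 1 ∷ # 7 ∷ # 6 ∷ []) ∷
    (# 5 ∷ # 3 ∷ # 6 ∷ # 1 ∷ # 7 ∷ # 2 ∷ # 0 ∷ # 4 ∷ []) ∷
    (# 3 ∷ # 4 ∷ # 7 ∷ # 2 ∷ # 6 ∷ # 0 ∷ # 5 ∷ # 1 ∷ []) ∷
    (# 1 ∷ # 6 ∷ # 0 ∷ # 4 ∷ # 3 ∷ # 5 ∷ # 2 ∷ # 7 ∷ []) ∷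
    (# 6 ∷ # 7 ∷ # 2 ∷ # 5 ∷ # 4 ∷ # 3 ∷ # 1 ∷ # 0 ∷ []) ∷
    (# 7 ∷ # 0 ∷ # 1 ∷ # 3 ∷ # 5 ∷ # 4 ∷ # 6 ∷ # 2 ∷ []) ∷
    (# 0 ∷ # 2 ∷ # 4 ∷ # 6 ∷ # 1 ∷ # 7 ∷ # 3 ∷ # 5 ∷ []) ∷
    (# 2 ∷ # 1 ∷ # 5 ∷ # 7 ∷ # 0 ∷ # 6 ∷ # 4 ∷ # 3 ∷ []) ∷ []) ∷
  ( (# 6 ∷ # 3 ∷ # 7 ∷ # 5 ∷ # 4 ∷ # 2 ∷ # 1 ∷ # 0 ∷ []) ∷
    (# 7 ∷ # 6 ∷ # 4 ∷ # 0 ∷ # 3 ∷ # 5 ∷ # 2 ∷ # 1 ∷ []) ∷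
    (# 5 ∷ # 7 ∷ # 6 ∷ # 3 ∷ # 1 ∷ # 4 ∷ # 0 ∷ # 2 ∷ []) ∷
    (# 0 ∷ # 2 ∷ # 5 ∷ # 6 ∷ # 7 ∷ # 1 ∷ # 3 ∷ # 4 ∷ []) ∷
    (# 3 ∷ # 1 ∷ # 0 ∷ # 2 ∷ # 6 ∷ # 7 ∷ # 4 ∷ # 5 ∷ []) ∷
    (# 1 ∷ # 4 ∷ # 2 ∷ # 7 ∷ # 0 ∷ # 6 ∷ # 5 ∷ # 3 ∷ []) ∷
    (# 2 ∷ # 0 ∷ # 1 ∷ # 4 ∷ # 5 ∷ # 3 ∷ # 6 ∷ # 7 ∷ []) ∷
    (# 4 ∷ # 5 ∷ # 3 ∷ # 1 ∷ # 2 ∷ # 0 ∷ # 7 ∷ # 6 ∷ []) ∷ []) ∷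
  ( (# 3 ∷ # 7 ∷ # 6 ∷ # 2 ∷ # 5 ∷ # 4 ∷ # 0 ∷ # 1 ∷ []) ∷
    (# 6 ∷ # 4 ∷ # 7 ∷ # 5 ∷ # 0 ∷ # 3 ∷ # 1 ∷ # 2 ∷ []) ∷
    (# 7 ∷ # 6 ∷ # 5 ∷ # 4 ∷ # 3 ∷ # 1 ∷ # 2 ∷ # 0 ∷ []) ∷
    (# 5 ∷ # 0 ∷ # 2 ∷ # 7 ∷ # 1 ∷ # 6 ∷ # 4 ∷ # 3 ∷ []) ∷
    (# 0 ∷ # 3 ∷ # 1 ∷ # 6 ∷ # 7 ∷ # 2 ∷ # 5 ∷ # 4 ∷ []) ∷
    (# 2 ∷ # 1 ∷ # 4 ∷ # 0 ∷ # 6 ∷ # 7 ∷ # 3 ∷ # 5 ∷ []) ∷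
    (# 4 ∷ # 5 ∷ # 3 ∷ # 1 ∷ # 2 ∷ # 0 ∷ # 7 ∷ # 6 ∷ []) ∷
    (# 1 ∷ # 2 ∷ # 0 ∷ # 3 ∷ # 4 ∷ # 5 ∷ # 6 ∷ # 7 ∷ []) ∷ []) ∷
  []

table₁₁ : Table 11
table₁₁ =
  ( (#  2 ∷ #  1 ∷ #  3 ∷ #  0 ∷ #  6 ∷ #  7 ∷ #  8 ∷ #  9 ∷ #  4 ∷ # 10 ∷ #  5 ∷ []) ∷
    (#  3 ∷ #  2 ∷ #  0 ∷ #  1 ∷ #  4 ∷ #  8 ∷ #  5 ∷ #  7 ∷ #  9 ∷ #  6 ∷ # 10 ∷ []) ∷
    (#  0 ∷ #  3 ∷ #  1 ∷ #  2 ∷ #  5 ∷ # 10 ∷ #  6 ∷ #  8 ∷ #  7 ∷ #  4 ∷ #  9 ∷ []) ∷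
    (#  1 ∷ #  0 ∷ #  2 ∷ #  3 ∷ # 10 ∷ #  4 ∷ #  7 ∷ #  6 ∷ #  5 ∷ #  9 ∷ #  8 ∷ []) ∷
    (#  4 ∷ # 10 ∷ #  8 ∷ #  5 ∷ #  9 ∷ #  2 ∷ #  1 ∷ #  3 ∷ #  6 ∷ #  7 ∷ #  0 ∷ []) ∷
    (#  9 ∷ #  6 ∷ #  7 ∷ #  4 ∷ #  8 ∷ #  0 ∷ #  2 ∷ #  1 ∷ # 10 ∷ #  5 ∷ #  3 ∷ []) ∷
    (#  6 ∷ #  5 ∷ #  9 ∷ #  7 ∷ #  1 ∷ #  3 ∷ # 10 ∷ #  2 ∷ #  8 ∷ #  0 ∷ #  4 ∷ []) ∷
    (#  7 ∷ #  4 ∷ #  5 ∷ # 10 ∷ #  2 ∷ #  9 ∷ #  3 ∷ #  0 ∷ #  1 ∷ #  8 ∷ #  6 ∷ []) ∷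
    (# 10 ∷ #  9 ∷ #  4 ∷ #  8 ∷ #  7 ∷ #  6 ∷ #  0 ∷ #  5 ∷ #  2 ∷ #  3 ∷ #  1 ∷ []) ∷
    (#  5 ∷ #  8 ∷ # 10 ∷ #  6 ∷ #  3 ∷ #  1 ∷ #  9 ∷ #  4 ∷ #  0 ∷ #  2 ∷ #  7 ∷ []) ∷
    (#  8 ∷ #  7 ∷ #  6 ∷ #  9 ∷ #  0 ∷ #  5 ∷ #  4 ∷ # 10 ∷ #  3 ∷ #  1 ∷ #  2 ∷ []) ∷ []) ∷
  ( (#  0 ∷ #  2 ∷ #  1 ∷ #  3 ∷ #  7 ∷ # 10 ∷ #  5 ∷ #  4 ∷ #  6 ∷ #  9 ∷ #  8 ∷ []) ∷
    (#  1 ∷ #  3 ∷ #  2 ∷ #  0 ∷ #  9 ∷ #  7 ∷ #  4 ∷ #  8 ∷ #  5 ∷ # 10 ∷ #  6 ∷ []) ∷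
    (#  2 ∷ #  0 ∷ #  3 ∷ #  1 ∷ #  4 ∷ #  5 ∷ #  8 ∷ #  6 ∷ #  9 ∷ #  7 ∷ # 10 ∷ []) ∷
    (#  3 ∷ #  1 ∷ #  0 ∷ #  2 ∷ #  8 ∷ #  6 ∷ # 10 ∷ #  7 ∷ #  4 ∷ #  5 ∷ #  9 ∷ []) ∷
    (# 10 ∷ #  4 ∷ #  5 ∷ #  6 ∷ #  1 ∷ #  3 ∷ #  9 ∷ #  0 ∷ #  2 ∷ #  8 ∷ #  7 ∷ []) ∷
    (#  6 ∷ #  5 ∷ # 10 ∷ #  8 ∷ #  0 ∷ #  9 ∷ #  3 ∷ #  2 ∷ #  7 ∷ #  4 ∷ #  1 ∷ []) ∷
    (#  5 ∷ #  9 ∷ #  7 ∷ #  4 ∷ #  2 ∷ #  8 ∷ #  1 ∷ #  3 ∷ # 10 ∷ #  6 ∷ #  0 ∷ []) ∷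
    (#  4 ∷ #  7 ∷ #  6 ∷ #  9 ∷ #  3 ∷ #  2 ∷ #  0 ∷ # 10 ∷ #  8 ∷ #  1 ∷ #  5 ∷ []) ∷
    (#  8 ∷ # 10 ∷ #  9 ∷ #  5 ∷ #  6 ∷ #  4 ∷ #  7 ∷ #  1 ∷ #  3 ∷ #  0 ∷ #  2 ∷ []) ∷
    (#  7 ∷ #  6 ∷ #  8 ∷ # 10 ∷ #  5 ∷ #  0 ∷ #  2 ∷ #  9 ∷ #  1 ∷ #  3 ∷ #  4 ∷ []) ∷
    (#  9 ∷ #  8 ∷ #  4 ∷ #  7 ∷ # 10 ∷ #  1 ∷ #  6 ∷ #  5 ∷ #  0 ∷ #  2 ∷ #  3 ∷ []) ∷ []) ∷
  ( (#  3 ∷ #  0 ∷ #  2 ∷ #  1 ∷ #  4 ∷ #  8 ∷ #  7 ∷ # 10 ∷ #  5 ∷ #  6 ∷ #  9 ∷ []) ∷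
    (#  0 ∷ #  1 ∷ #  3 ∷ #  2 ∷ #  5 ∷ #  4 ∷ # 10 ∷ #  6 ∷ #  7 ∷ #  9 ∷ #  8 ∷ []) ∷
    (#  1 ∷ #  2 ∷ #  0 ∷ #  3 ∷ #  8 ∷ #  9 ∷ #  4 ∷ #  5 ∷ #  6 ∷ # 10 ∷ #  7 ∷ []) ∷
    (#  2 ∷ #  3 ∷ #  1 ∷ #  0 ∷ #  7 ∷ #  5 ∷ #  6 ∷ #  8 ∷ #  9 ∷ #  4 ∷ # 10 ∷ []) ∷
    (#  9 ∷ #  5 ∷ #  4 ∷ #  7 ∷ # 10 ∷ #  0 ∷ #  3 ∷ #  1 ∷ #  8 ∷ #  2 ∷ #  6 ∷ []) ∷
    (#  7 ∷ # 10 ∷ #  5 ∷ #  6 ∷ #  1 ∷ #  2 ∷ #  0 ∷ #  9 ∷ #  3 ∷ #  8 ∷ #  4 ∷ []) ∷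
    (#  8 ∷ #  7 ∷ #  6 ∷ # 10 ∷ #  3 ∷ #  1 ∷ #  9 ∷ #  0 ∷ #  4 ∷ #  5 ∷ #  2 ∷ []) ∷
    (#  5 ∷ #  6 ∷ #  9 ∷ #  4 ∷ #  0 ∷ #  3 ∷ #  8 ∷ #  2 ∷ # 10 ∷ #  7 ∷ #  1 ∷ []) ∷
    (#  6 ∷ #  8 ∷ # 10 ∷ #  9 ∷ #  2 ∷ #  7 ∷ #  5 ∷ #  4 ∷ #  0 ∷ #  1 ∷ #  3 ∷ []) ∷
    (# 10 ∷ #  4 ∷ #  7 ∷ #  8 ∷ #  9 ∷ #  6 ∷ #  1 ∷ #  3 ∷ #  2 ∷ #  0 ∷ #  5 ∷ []) ∷
    (#  4 ∷ #  9 ∷ #  8 ∷ #  5 ∷ #  6 ∷ # 10 ∷ #  2 ∷ #  7 ∷ #  1 ∷ #  3 ∷ #  0 ∷ []) ∷ []) ∷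
  ( (#  1 ∷ #  3 ∷ #  0 ∷ #  2 ∷ #  8 ∷ #  4 ∷ #  6 ∷ #  7 ∷ #  9 ∷ #  5 ∷ # 10 ∷ []) ∷
    (#  2 ∷ #  0 ∷ #  1 ∷ #  3 ∷ # 10 ∷ #  5 ∷ #  8 ∷ #  4 ∷ #  6 ∷ #  7 ∷ #  9 ∷ []) ∷
    (#  3 ∷ #  1 ∷ #  2 ∷ #  0 ∷ #  7 ∷ #  6 ∷ #  5 ∷ # 10 ∷ #  4 ∷ #  9 ∷ #  8 ∷ []) ∷
    (#  0 ∷ #  2 ∷ #  3 ∷ #  1 ∷ #  6 ∷ #  8 ∷ #  9 ∷ #  5 ∷ #  7 ∷ # 10 ∷ #  4 ∷ []) ∷
    (#  5 ∷ #  6 ∷ #  7 ∷ #  9 ∷ #  3 ∷ #  1 ∷ #  0 ∷ #  8 ∷ # 10 ∷ #  4 ∷ #  2 ∷ []) ∷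
    (#  4 ∷ #  9 ∷ #  6 ∷ #  5 ∷ #  2 ∷ # 10 ∷ #  1 ∷ #  0 ∷ #  8 ∷ #  3 ∷ #  7 ∷ []) ∷
    (#  7 ∷ #  4 ∷ # 10 ∷ #  6 ∷ #  9 ∷ #  2 ∷ #  3 ∷ #  1 ∷ #  0 ∷ #  8 ∷ #  5 ∷ []) ∷
    (# 10 ∷ #  8 ∷ #  4 ∷ #  7 ∷ #  1 ∷ #  0 ∷ #  2 ∷ #  9 ∷ #  5 ∷ #  6 ∷ #  3 ∷ []) ∷
    (#  9 ∷ #  7 ∷ #  8 ∷ # 10 ∷ #  5 ∷ #  3 ∷ #  4 ∷ #  6 ∷ #  1 ∷ #  2 ∷ #  0 ∷ []) ∷
    (#  8 ∷ # 10 ∷ #  5 ∷ #  4 ∷ #  0 ∷ #  9 ∷ #  7 ∷ #  2 ∷ #  3 ∷ #  1 ∷ #  6 ∷ []) ∷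
    (#  6 ∷ #  5 ∷ #  9 ∷ #  8 ∷ #  4 ∷ #  7 ∷ # 10 ∷ #  3 ∷ #  2 ∷ #  0 ∷ #  1 ∷ []) ∷ []) ∷
  ( (#  6 ∷ #  5 ∷ #  4 ∷ #  7 ∷ # 10 ∷ #  0 ∷ #  9 ∷ #  8 ∷ #  2 ∷ #  3 ∷ #  1 ∷ []) ∷
    (#  7 ∷ #  4 ∷ #  5 ∷ #  6 ∷ #  1 ∷ #  9 ∷ #  0 ∷ # 10 ∷ #  8 ∷ #  2 ∷ #  3 ∷ []) ∷
    (# 10 ∷ #  7 ∷ #  8 ∷ #  9 ∷ #  2 ∷ #  3 ∷ #  1 ∷ #  0 ∷ #  5 ∷ #  6 ∷ #  4 ∷ []) ∷
    (#  5 ∷ #  9 ∷ #  7 ∷ #  4 ∷ #  0 ∷ #  1 ∷ #  2 ∷ #  3 ∷ # 10 ∷ #  8 ∷ #  6 ∷ []) ∷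
    (#  2 ∷ #  8 ∷ # 10 ∷ #  1 ∷ #  7 ∷ #  5 ∷ #  4 ∷ #  6 ∷ #  3 ∷ #  0 ∷ #  9 ∷ []) ∷
    (#  8 ∷ #  0 ∷ #  3 ∷ #  2 ∷ #  4 ∷ #  6 ∷ #  5 ∷ #  7 ∷ #  1 ∷ #  9 ∷ # 10 ∷ []) ∷
    (#  0 ∷ # 10 ∷ #  2 ∷ #  3 ∷ #  5 ∷ #  7 ∷ #  6 ∷ #  4 ∷ #  9 ∷ #  1 ∷ #  8 ∷ []) ∷
    (#  9 ∷ #  3 ∷ #  1 ∷ #  8 ∷ #  6 ∷ #  4 ∷ #  7 ∷ #  5 ∷ #  0 ∷ # 10 ∷ #  2 ∷ []) ∷
    (#  3 ∷ #  1 ∷ #  6 ∷ #  0 ∷ #  9 ∷ #  8 ∷ # 10 ∷ #  2 ∷ #  7 ∷ #  4 ∷ #  5 ∷ []) ∷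
    (#  4 ∷ #  2 ∷ #  9 ∷ #  5 ∷ #  8 ∷ # 10 ∷ #  3 ∷ #  1 ∷ #  6 ∷ #  7 ∷ #  0 ∷ []) ∷
    (#  1 ∷ #  6 ∷ #  0 ∷ # 10 ∷ #  3 ∷ #  2 ∷ #  8 ∷ #  9 ∷ #  4 ∷ #  5 ∷ #  7 ∷ []) ∷ []) ∷
  ( (#  5 ∷ #  6 ∷ #  9 ∷ #  4 ∷ #  0 ∷ #  1 ∷ #  2 ∷ #  3 ∷ # 10 ∷ #  8 ∷ #  7 ∷ []) ∷
    (#  4 ∷ #  7 ∷ #  6 ∷ #  5 ∷ #  8 ∷ # 10 ∷ #  1 ∷ #  9 ∷ #  3 ∷ #  0 ∷ #  2 ∷ []) ∷
    (#  7 ∷ #  4 ∷ #  5 ∷ #  6 ∷ # 10 ∷ #  2 ∷ #  9 ∷ #  1 ∷ #  8 ∷ #  3 ∷ #  0 ∷ []) ∷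
    (#  9 ∷ # 10 ∷ #  4 ∷ #  8 ∷ #  1 ∷ #  3 ∷ #  0 ∷ #  2 ∷ #  6 ∷ #  7 ∷ #  5 ∷ []) ∷
    (#  8 ∷ #  9 ∷ #  0 ∷ #  2 ∷ #  6 ∷ #  7 ∷ #  5 ∷ #  4 ∷ #  1 ∷ # 10 ∷ #  3 ∷ []) ∷
    (#  2 ∷ #  3 ∷ #  8 ∷ # 10 ∷ #  7 ∷ #  4 ∷ #  6 ∷ #  5 ∷ #  0 ∷ #  1 ∷ #  9 ∷ []) ∷
    (#  3 ∷ #  8 ∷ #  1 ∷ #  0 ∷ #  4 ∷ #  5 ∷ #  7 ∷ #  6 ∷ #  2 ∷ #  9 ∷ # 10 ∷ []) ∷
    (#  0 ∷ #  1 ∷ # 10 ∷ #  3 ∷ #  5 ∷ #  6 ∷ #  4 ∷ #  7 ∷ #  9 ∷ #  2 ∷ #  8 ∷ []) ∷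
    (#  1 ∷ #  0 ∷ #  2 ∷ #  7 ∷ #  3 ∷ #  9 ∷ #  8 ∷ # 10 ∷ #  4 ∷ #  5 ∷ #  6 ∷ []) ∷
    (#  6 ∷ #  5 ∷ #  3 ∷ #  9 ∷ #  2 ∷ #  8 ∷ # 10 ∷ #  0 ∷ #  7 ∷ #  4 ∷ #  1 ∷ []) ∷
    (# 10 ∷ #  2 ∷ #  7 ∷ #  1 ∷ #  9 ∷ #  0 ∷ #  3 ∷ #  8 ∷ #  5 ∷ #  6 ∷ #  4 ∷ []) ∷ []) ∷
  ( (#  8 ∷ #  9 ∷ # 10 ∷ #  5 ∷ #  3 ∷ #  2 ∷ #  0 ∷ #  1 ∷ #  7 ∷ #  4 ∷ #  6 ∷ []) ∷
    (#  5 ∷ #  6 ∷ #  7 ∷ #  9 ∷ #  0 ∷ #  1 ∷ #  2 ∷ #  3 ∷ # 10 ∷ #  8 ∷ #  4 ∷ []) ∷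
    (#  6 ∷ #  5 ∷ #  4 ∷ #  7 ∷ #  9 ∷ #  8 ∷ # 10 ∷ #  2 ∷ #  0 ∷ #  1 ∷ #  3 ∷ []) ∷
    (#  7 ∷ #  4 ∷ #  5 ∷ #  6 ∷ #  2 ∷ # 10 ∷ #  3 ∷ #  9 ∷ #  8 ∷ #  0 ∷ #  1 ∷ []) ∷
    (#  0 ∷ #  1 ∷ #  2 ∷ # 10 ∷ #  4 ∷ #  6 ∷ #  7 ∷ #  5 ∷ #  9 ∷ #  3 ∷ #  8 ∷ []) ∷
    (#  3 ∷ #  8 ∷ #  9 ∷ #  1 ∷ #  5 ∷ #  7 ∷ #  4 ∷ #  6 ∷ #  2 ∷ # 10 ∷ #  0 ∷ []) ∷
    (# 10 ∷ #  3 ∷ #  0 ∷ #  8 ∷ #  6 ∷ #  4 ∷ #  5 ∷ #  7 ∷ #  1 ∷ #  2 ∷ #  9 ∷ []) ∷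
    (#  1 ∷ #  0 ∷ #  8 ∷ #  2 ∷ #  7 ∷ #  5 ∷ #  6 ∷ #  4 ∷ #  3 ∷ #  9 ∷ # 10 ∷ []) ∷
    (#  4 ∷ #  2 ∷ #  1 ∷ #  3 ∷ # 10 ∷ #  0 ∷ #  9 ∷ #  8 ∷ #  5 ∷ #  6 ∷ #  7 ∷ []) ∷
    (#  9 ∷ #  7 ∷ #  6 ∷ #  0 ∷ #  1 ∷ #  3 ∷ #  8 ∷ # 10 ∷ #  4 ∷ #  5 ∷ #  2 ∷ []) ∷
    (#  2 ∷ # 10 ∷ #  3 ∷ #  4 ∷ #  8 ∷ #  9 ∷ #  1 ∷ #  0 ∷ #  6 ∷ #  7 ∷ #  5 ∷ []) ∷ []) ∷
  ( (#  7 ∷ #  4 ∷ #  5 ∷ #  6 ∷ #  9 ∷ #  3 ∷ # 10 ∷ #  0 ∷ #  8 ∷ #  1 ∷ #  2 ∷ []) ∷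
    (#  6 ∷ #  8 ∷ #  9 ∷ # 10 ∷ #  2 ∷ #  0 ∷ #  3 ∷ #  1 ∷ #  4 ∷ #  5 ∷ #  7 ∷ []) ∷
    (#  9 ∷ #  6 ∷ #  7 ∷ #  4 ∷ #  0 ∷ #  1 ∷ #  2 ∷ #  3 ∷ # 10 ∷ #  8 ∷ #  5 ∷ []) ∷
    (#  4 ∷ #  7 ∷ #  6 ∷ #  5 ∷ #  3 ∷ #  9 ∷ #  8 ∷ # 10 ∷ #  1 ∷ #  2 ∷ #  0 ∷ []) ∷
    (#  3 ∷ #  2 ∷ #  1 ∷ #  8 ∷ #  5 ∷ #  4 ∷ #  6 ∷ #  7 ∷ #  0 ∷ #  9 ∷ # 10 ∷ []) ∷
    (# 10 ∷ #  1 ∷ #  2 ∷ #  3 ∷ #  6 ∷ #  5 ∷ #  7 ∷ #  4 ∷ #  9 ∷ #  0 ∷ #  8 ∷ []) ∷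
    (#  2 ∷ #  0 ∷ #  8 ∷ #  9 ∷ #  7 ∷ #  6 ∷ #  4 ∷ #  5 ∷ #  3 ∷ # 10 ∷ #  1 ∷ []) ∷
    (#  8 ∷ # 10 ∷ #  0 ∷ #  1 ∷ #  4 ∷ #  7 ∷ #  5 ∷ #  6 ∷ #  2 ∷ #  3 ∷ #  9 ∷ []) ∷
    (#  0 ∷ #  5 ∷ #  3 ∷ #  2 ∷ #  8 ∷ # 10 ∷ #  1 ∷ #  9 ∷ #  6 ∷ #  7 ∷ #  4 ∷ []) ∷
    (#  1 ∷ #  9 ∷ #  4 ∷ #  7 ∷ # 10 ∷ #  2 ∷ #  0 ∷ #  8 ∷ #  5 ∷ #  6 ∷ #  3 ∷ []) ∷
    (#  5 ∷ #  3 ∷ # 10 ∷ #  0 ∷ #  1 ∷ #  8 ∷ #  9 ∷ #  2 ∷ #  7 ∷ #  4 ∷ #  6 ∷ []) ∷ []) ∷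
  ( (# 10 ∷ #  7 ∷ #  8 ∷ #  9 ∷ #  2 ∷ #  6 ∷ #  1 ∷ #  5 ∷ #  3 ∷ #  0 ∷ #  4 ∷ []) ∷
    (#  9 ∷ # 10 ∷ #  4 ∷ #  8 ∷ #  6 ∷ #  3 ∷ #  7 ∷ #  2 ∷ #  0 ∷ #  1 ∷ #  5 ∷ []) ∷
    (#  8 ∷ #  9 ∷ # 10 ∷ #  5 ∷ #  3 ∷ #  7 ∷ #  0 ∷ #  4 ∷ #  1 ∷ #  2 ∷ #  6 ∷ []) ∷
    (#  6 ∷ #  8 ∷ #  9 ∷ # 10 ∷ #  5 ∷ #  0 ∷ #  4 ∷ #  1 ∷ #  2 ∷ #  3 ∷ #  7 ∷ []) ∷
    (#  7 ∷ #  3 ∷ #  6 ∷ #  0 ∷ #  8 ∷ #  9 ∷ #  2 ∷ # 10 ∷ #  4 ∷ #  5 ∷ #  1 ∷ []) ∷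
    (#  1 ∷ #  4 ∷ #  0 ∷ #  7 ∷ # 10 ∷ #  8 ∷ #  9 ∷ #  3 ∷ #  5 ∷ #  6 ∷ #  2 ∷ []) ∷
    (#  4 ∷ #  2 ∷ #  5 ∷ #  1 ∷ #  0 ∷ # 10 ∷ #  8 ∷ #  9 ∷ #  6 ∷ #  7 ∷ #  3 ∷ []) ∷
    (#  2 ∷ #  5 ∷ #  3 ∷ #  6 ∷ #  9 ∷ #  1 ∷ # 10 ∷ #  8 ∷ #  7 ∷ #  4 ∷ #  0 ∷ []) ∷
    (#  5 ∷ #  6 ∷ #  7 ∷ #  4 ∷ #  1 ∷ #  2 ∷ #  3 ∷ #  0 ∷ #  9 ∷ # 10 ∷ #  8 ∷ []) ∷
    (#  0 ∷ #  1 ∷ #  2 ∷ #  3 ∷ #  4 ∷ #  5 ∷ #  6 ∷ #  7 ∷ #  8 ∷ #  9 ∷ # 10 ∷ []) ∷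
    (#  3 ∷ #  0 ∷ #  1 ∷ #  2 ∷ #  7 ∷ #  4 ∷ #  5 ∷ #  6 ∷ # 10 ∷ #  8 ∷ #  9 ∷ []) ∷ []) ∷
  ( (#  9 ∷ #  8 ∷ #  6 ∷ # 10 ∷ #  1 ∷ #  5 ∷ #  4 ∷ #  2 ∷ #  0 ∷ #  7 ∷ #  3 ∷ []) ∷
    (# 10 ∷ #  9 ∷ #  8 ∷ #  7 ∷ #  3 ∷ #  2 ∷ #  6 ∷ #  5 ∷ #  1 ∷ #  4 ∷ #  0 ∷ []) ∷
    (#  4 ∷ # 10 ∷ #  9 ∷ #  8 ∷ #  6 ∷ #  0 ∷ #  3 ∷ #  7 ∷ #  2 ∷ #  5 ∷ #  1 ∷ []) ∷
    (#  8 ∷ #  5 ∷ # 10 ∷ #  9 ∷ #  4 ∷ #  7 ∷ #  1 ∷ #  0 ∷ #  3 ∷ #  6 ∷ #  2 ∷ []) ∷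
    (#  6 ∷ #  0 ∷ #  3 ∷ #  4 ∷ #  2 ∷ # 10 ∷ #  8 ∷ #  9 ∷ #  7 ∷ #  1 ∷ #  5 ∷ []) ∷
    (#  5 ∷ #  7 ∷ #  1 ∷ #  0 ∷ #  9 ∷ #  3 ∷ # 10 ∷ #  8 ∷ #  4 ∷ #  2 ∷ #  6 ∷ []) ∷
    (#  1 ∷ #  6 ∷ #  4 ∷ #  2 ∷ #  8 ∷ #  9 ∷ #  0 ∷ # 10 ∷ #  5 ∷ #  3 ∷ #  7 ∷ []) ∷
    (#  3 ∷ #  2 ∷ #  7 ∷ #  5 ∷ # 10 ∷ #  8 ∷ #  9 ∷ #  1 ∷ #  6 ∷ #  0 ∷ #  4 ∷ []) ∷
    (#  7 ∷ #  4 ∷ #  5 ∷ #  6 ∷ #  0 ∷ #  1 ∷ #  2 ∷ #  3 ∷ #  8 ∷ #  9 ∷ # 10 ∷ []) ∷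
    (#  2 ∷ #  3 ∷ #  0 ∷ #  1 ∷ #  7 ∷ #  4 ∷ #  5 ∷ #  6 ∷ # 10 ∷ #  8 ∷ #  9 ∷ []) ∷
    (#  0 ∷ #  1 ∷ #  2 ∷ #  3 ∷ #  5 ∷ #  6 ∷ #  7 ∷ #  4 ∷ #  9 ∷ # 10 ∷ #  8 ∷ []) ∷ []) ∷
  ( (#  4 ∷ # 10 ∷ #  7 ∷ #  8 ∷ #  5 ∷ #  9 ∷ #  3 ∷ #  6 ∷ #  1 ∷ #  2 ∷ #  0 ∷ []) ∷
    (#  8 ∷ #  5 ∷ # 10 ∷ #  4 ∷ #  7 ∷ #  6 ∷ #  9 ∷ #  0 ∷ #  2 ∷ #  3 ∷ #  1 ∷ []) ∷
    (#  5 ∷ #  8 ∷ #  6 ∷ # 10 ∷ #  1 ∷ #  4 ∷ #  7 ∷ #  9 ∷ #  3 ∷ #  0 ∷ #  2 ∷ []) ∷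
    (# 10 ∷ #  6 ∷ #  8 ∷ #  7 ∷ #  9 ∷ #  2 ∷ #  5 ∷ #  4 ∷ #  0 ∷ #  1 ∷ #  3 ∷ []) ∷
    (#  1 ∷ #  7 ∷ #  9 ∷ #  3 ∷ #  0 ∷ #  8 ∷ # 10 ∷ #  2 ∷ #  5 ∷ #  6 ∷ #  4 ∷ []) ∷
    (#  0 ∷ #  2 ∷ #  4 ∷ #  9 ∷ #  3 ∷ #  1 ∷ #  8 ∷ # 10 ∷ #  6 ∷ #  7 ∷ #  5 ∷ []) ∷
    (#  9 ∷ #  1 ∷ #  3 ∷ #  5 ∷ # 10 ∷ #  0 ∷ #  2 ∷ #  8 ∷ #  7 ∷ #  4 ∷ #  6 ∷ []) ∷
    (#  6 ∷ #  9 ∷ #  2 ∷ #  0 ∷ #  8 ∷ # 10 ∷ #  1 ∷ #  3 ∷ #  4 ∷ #  5 ∷ #  7 ∷ []) ∷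
    (#  2 ∷ #  3 ∷ #  0 ∷ #  1 ∷ #  4 ∷ #  5 ∷ #  6 ∷ #  7 ∷ # 10 ∷ #  8 ∷ #  9 ∷ []) ∷
    (#  3 ∷ #  0 ∷ #  1 ∷ #  2 ∷ #  6 ∷ #  7 ∷ #  4 ∷ #  5 ∷ #  9 ∷ # 10 ∷ #  8 ∷ []) ∷
    (#  7 ∷ #  4 ∷ #  5 ∷ #  6 ∷ #  2 ∷ #  3 ∷ #  0 ∷ #  1 ∷ #  8 ∷ #  9 ∷ # 10 ∷ []) ∷ []) ∷
  []

lc₅ : LC-x²y¹ 2 1
lc₅ = diagonalLC 2 1 (fromTable table₅) (from-yes (isDiagonalLC? 2 1 (fromTable table₅)))

lc₈ : LC-x²y¹ 3 2
lc₈ = diagonalLC 3 2 (fromTable table₈) (from-yes (isDiagonalLC? 3 2 (fromTable table₈)))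

lc₁₁ : LC-x²y¹ 4 3
lc₁₁ = diagonalLC 4 3 (fromTable table₁₁) (from-yes (isDiagonalLC? 4 3 (fromTable table₁₁)))

lemma16 : ∀ (b : ℕ) → b ≥ 1 →
    LC-x²y¹ (2 * b) b × LC-x²y¹ (3 * b) (2 * b) × LC-x²y¹ (4 * b) (3 * b)
lemma16 b b≥1 =
    subst (LC-x²y¹ (2 * b)) (*-identityˡ b) (LC-x²y¹-scale b lc₅)
  , LC-x²y¹-scale b lc₈
  , LC-x²y¹-scale b lc₁₁
  where
  instance
    b≢0 : NonZero b
    b≢0 = >-nonZero b≥1
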